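{- Let $G=(V,E)$ be a graph on $n$ vertices with maximum degree $\Delta$, and let $t:V\to\mathbb{N}$ be a threshold function with $t(v)\ge\frac{1}{2}d(v)$ for every $v\in V$. If $(G,t)$ has a contagious set of size $r$, then $CW(G)\le\Delta r$.
   Context: For a graph $G$ with threshold function $t$, the activation process starts with an active set $S$, and in discrete time steps every inactive vertex $v$ having at least $t(v)$ neighbors that were active in the previous step becomes active; $S$ is contagious (a target set) if eventually all vertices are active. The cutwidth $CW(G)$ is the minimum, over all linear orderings $\sigma$ of $V$, of the maximum over all prefixes of $\sigma$ of the number of edges with exactly one endpoint in the prefix. $d(v)$ is the degree of $v$. -}

module Defs where

open import Data.Nat using (ℕ; zero; suc; _+_; _*_; _≤_; _⊔_)
open import Data.Bool using (Bool; true; false; _∧_; _∨_; not; if_then_else_)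
open import Data.Fin using (Fin; toℕ)
open import Data.Fin.Permutation using (Permutation′; _⟨$⟩ʳ_; _⟨$⟩ˡ_)
open import Data.List using (List; map; allFin; foldr)
open import Data.Nat.ListAction using (sum)
open import Data.Nat using (_<ᵇ_; _≤ᵇ_)
open import Data.Product using (∃; _×_)
open import Relation.Binary.PropositionalEquality using (_≡_)

count : {n : ℕ} → (Fin n → Bool) → ℕ
count {n} p = sum (map (λ v → if p v then 1 else 0) (allFin n))

maxFin : {n : ℕ} → (Fin n → ℕ) → ℕ
maxFin {n} f = foldr _⊔_ 0 (map f (allFin n))

record Graph (n : ℕ) : Set where
  field
    adj   : Fin n → Fin n → Bool
    sym   : ∀ u v → adj u v ≡ adj v u
    loopless : ∀ v → adj v v ≡ false
open Graph public

deg : {n : ℕ} → Graph n → Fin n → ℕ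
deg G v = count (adj G v)

maxDeg : {n : ℕ} → Graph n → ℕ
maxDeg G = maxFin (deg G)

Subset : ℕ → Set
Subset n = Fin n → Bool

active : {n : ℕ} → Graph n → (Fin n → ℕ) → Subset n → ℕ → Subset n
active G t S zero = S
active G t S (suc k) v =
  active G t S k v ∨ (t v ≤ᵇ count (λ u → adj G v u ∧ active G t S k u))

Contagious : {n : ℕ} → Graph n → (Fin n → ℕ) → Subset n → Set
Contagious G t S = ∃ λ k → ∀ v → active G t S k v ≡ true

-- a linear ordering σ of V: σ maps positions to vertices
-- prefix of length i: vertices at positions < i
inPrefix : {n : ℕ} → Permutation′ n → ℕ → Subset n
inPrefix σ i v = toℕ (σ ⟨$⟩ˡ v) <ᵇ i

-- number of edges with exactly one endpoint in the prefix of length i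
-- (each such edge {u,w} is counted once, as the pair with u in the prefix)
cutSize : {n : ℕ} → Graph n → Permutation′ n → ℕ → ℕ
cutSize {n} G σ i =
  sum (map (λ u → count (λ w → inPrefix σ i u ∧ adj G u w ∧ not (inPrefix σ i w)))
           (allFin n))

width : {n : ℕ} → Graph n → Permutation′ n → ℕ
width {n} G σ = maxFin {suc n} (λ i → cutSize G σ (toℕ i))

-- Order the vertices by activation time, breaking ties by index. A vertex
-- outside S activated at step k + 1 has at least t(v) neighbours active at
-- step k, and all of them precede it. For a prefix P of this order, summing
-- degrees over P counts each edge leaving P once and each edge inside P twice,
-- while each edge inside P is backward (to an earlier vertex) at exactly one
-- endpoint. Bounding d(v) by Δ on S and by 2 t(v) ≤ 2 · #backward edges at v
-- off S therefore gives  cut(P) + 2 e(P) ≤ Δ |S| + 2 e(P).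

module Submission where

open import Defs hiding (sym)
open import Data.Nat using (ℕ; zero; suc; _+_; _*_; _≤_; _<_; _≮_; _<ᵇ_; _⊔_; z≤n; s≤s; s≤s⁻¹; z<s)
open import Data.Nat.Properties
open import Data.Bool using (Bool; true; false; _∧_; _∨_; not; if_then_else_)
open import Data.Bool.Properties using (∧-zeroʳ; T-≡; not-¬)
import Data.Fin as Fin
open Fin using (Fin; toℕ; fromℕ<)
open import Data.Fin.Properties using (toℕ<n; toℕ-injective; toℕ-fromℕ<; any?; punchOut-injective; <⇒notInjective)
open import Data.Fin.Permutation using (Permutation′; permutation; _⟨$⟩ˡ_; _⟨$⟩ʳ_; inverseʳ)
open import Data.List using (List; []; _∷_; map; allFin; foldr; tabulate)
open import Data.List.Properties using (map-tabulate)
import Data.Nat.ListAction as ListAction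
open import Algebra.Properties.Semiring.Sum +-*-semiring
  using (sum; sum-syntax; ∑-distrib-+; ∑-comm; sum-cong-≗; *-distribˡ-sum; *-distribʳ-sum)
open import Data.Product using (∃; ∃-syntax; _×_; _,_; proj₁; proj₂; map₂)
open import Function using (_∘_; id)
open import Function.Bundles using (Equivalence)
open import Function.Definitions using (Injective)
open import Relation.Binary.PropositionalEquality
open import Relation.Binary.Definitions using (tri<; tri≈; tri>)
open import Relation.Nullary using (contradiction; yes; no)
open import Relation.Nullary.Reflects using (ofʸ)

private
  variable
    n : ℕ

𝟙 : Bool → ℕ
𝟙 b = if b then 1 else 0

true≢false : true ≢ false
true≢false ()

∨-resolveˡ : ∀ {a b} → a ≡ false → (a ∨ b) ≡ true → b ≡ true
∨-resolveˡ refl b≡true = b≡true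

<ᵇ-true : ∀ {m k} → m < k → (m <ᵇ k) ≡ true
<ᵇ-true m<k = Equivalence.to T-≡ (<⇒<ᵇ m<k)

<ᵇ-false : ∀ {m k} → m ≮ k → (m <ᵇ k) ≡ false
<ᵇ-false {m} {k} m≮k with m <ᵇ k | <ᵇ-reflects-< m k
... | false | _      = refl
... | true  | ofʸ m<k = contradiction m<k m≮k

<ᵇ-irrefl : ∀ m → (m <ᵇ m) ≡ false
<ᵇ-irrefl m = <ᵇ-false {m} (<-irrefl refl)

<ᵇ-true⇒< : ∀ {m k} → (m <ᵇ k) ≡ true → m < k
<ᵇ-true⇒< {m} {k} eq = <ᵇ⇒< m k (Equivalence.from T-≡ eq)

<ᵇ-flip : ∀ {m k} → m ≢ k → (k <ᵇ m) ≡ not (m <ᵇ k)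
<ᵇ-flip {m} {k} m≢k with <-cmp m k
... | tri< m<k _ k≮m = trans (<ᵇ-false k≮m) (cong not (sym (<ᵇ-true m<k)))
... | tri≈ _ m≡k _  = contradiction m≡k m≢k
... | tri> m≮k _ k<m = trans (<ᵇ-true k<m) (cong not (sym (<ᵇ-false m≮k)))

𝟙-mono : ∀ {a b} → (a ≡ true → b ≡ true) → 𝟙 a ≤ 𝟙 b
𝟙-mono {false} a⇒b = z≤n
𝟙-mono {true}  a⇒b rewrite a⇒b refl = ≤-refl

𝟙-∧-split : ∀ a b c → 𝟙 a * 𝟙 b ≡ 𝟙 (a ∧ b ∧ not c) + 𝟙 (a ∧ b ∧ c)
𝟙-∧-split true  true  true  = refl
𝟙-∧-split true  true  false = refl
𝟙-∧-split true  false c     = refl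
𝟙-∧-split false b     c     = refl

𝟙-∧-partition : ∀ b x y → (x ≡ y → b ≡ false) → 𝟙 b ≡ 𝟙 (b ∧ x) + 𝟙 (b ∧ y)
𝟙-∧-partition false x     y     _        = refl
𝟙-∧-partition true  true  false _        = refl
𝟙-∧-partition true  false true  _        = refl
𝟙-∧-partition true  true  true  x≡y⇒b≡f = contradiction (x≡y⇒b≡f refl) true≢false
𝟙-∧-partition true  false false x≡y⇒b≡f = contradiction (x≡y⇒b≡f refl) true≢false

∧-reverse : ∀ a b c → a ∧ b ∧ c ≡ c ∧ b ∧ a
∧-reverse false b false = refl
∧-reverse false b true  = sym (∧-zeroʳ b)
∧-reverse true  b false = ∧-zeroʳ b
∧-reverse true  b true  = refl

𝟙*-≤ : ∀ {d x} b → (b ≡ true → d ≤ x) → 𝟙 b * d ≤ x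
𝟙*-≤ false _     = z≤n
𝟙*-≤ true  b⇒d≤x = ≤-trans (≤-reflexive (*-identityˡ _)) (b⇒d≤x refl)

∑-mono-≤ : {f g : Fin n → ℕ} → (∀ i → f i ≤ g i) → sum f ≤ sum g
∑-mono-≤ {zero}  f≤g = z≤n
∑-mono-≤ {suc n} f≤g = +-mono-≤ (f≤g Fin.zero) (∑-mono-≤ (f≤g ∘ Fin.suc))

∑-mono-< : {f g : Fin n → ℕ} → (∀ i → f i ≤ g i) → ∀ j → f j < g j → sum f < sum g
∑-mono-< {suc n} f≤g Fin.zero    fj<gj = +-mono-<-≤ fj<gj (∑-mono-≤ (f≤g ∘ Fin.suc))
∑-mono-< {suc n} f≤g (Fin.suc j) fj<gj = +-mono-≤-< (f≤g Fin.zero) (∑-mono-< (f≤g ∘ Fin.suc) j fj<gj)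

∑-const-1 : ∀ n → ∑[ i < n ] 1 ≡ n
∑-const-1 zero    = refl
∑-const-1 (suc n) = cong suc (∑-const-1 n)

sum-map-allFin : (f : Fin n → ℕ) → ListAction.sum (map f (allFin n)) ≡ sum f
sum-map-allFin {n} f = trans (cong ListAction.sum (map-tabulate id f)) (sum-tabulate f)
  where
  sum-tabulate : ∀ {m} (g : Fin m → ℕ) → ListAction.sum (tabulate g) ≡ sum g
  sum-tabulate {zero}  g = refl
  sum-tabulate {suc m} g = cong (g Fin.zero +_) (sum-tabulate (g ∘ Fin.suc))

count≡∑ : (p : Subset n) → count p ≡ ∑[ v < n ] 𝟙 (p v)
count≡∑ p = sum-map-allFin (𝟙 ∘ p)

count-mono : {p q : Subset n} → (∀ v → p v ≡ true → q v ≡ true) → count p ≤ count q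
count-mono {p = p} {q} p⊆q = subst₂ _≤_ (sym (count≡∑ p)) (sym (count≡∑ q)) (∑-mono-≤ (λ v → 𝟙-mono (p⊆q v)))

count-mono-< : {p q : Subset n} → (∀ v → p v ≡ true → q v ≡ true)
  → ∀ v → p v ≡ false → q v ≡ true → count p < count q
count-mono-< {p = p} {q} p⊆q v pv≡f qv≡t = subst₂ _<_ (sym (count≡∑ p)) (sym (count≡∑ q))
  (∑-mono-< (λ w → 𝟙-mono (p⊆q w)) v (subst₂ (λ a b → 𝟙 a < 𝟙 b) (sym pv≡f) (sym qv≡t) z<s))

count-true : ∀ n → count {n} (λ _ → true) ≡ n
count-true n = trans (count≡∑ {n} (λ _ → true)) (∑-const-1 n)

maxFin-lub : {f : Fin n → ℕ} {b : ℕ} → (∀ i → f i ≤ b) → maxFin f ≤ b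
maxFin-lub {n} {f} {b} f≤b = go (allFin n)
  where
  go : (xs : List (Fin n)) → foldr _⊔_ 0 (map f xs) ≤ b
  go []       = z≤n
  go (x ∷ xs) = ⊔-lub (f≤b x) (go xs)

≤maxFin : (f : Fin n → ℕ) (i : Fin n) → f i ≤ maxFin f
≤maxFin f i = subst (λ xs → f i ≤ foldr _⊔_ 0 xs) (sym (map-tabulate id f)) (go f i)
  where
  go : ∀ {m} (g : Fin m → ℕ) (j : Fin m) → g j ≤ foldr _⊔_ 0 (tabulate g)
  go g Fin.zero    = m≤m⊔n _ _
  go g (Fin.suc j) = ≤-trans (go (g ∘ Fin.suc) j) (m≤n⊔m (g Fin.zero) _)

least-true : (f : ℕ → Bool) (k : ℕ) → f k ≡ true → ∃[ m ] f m ≡ true × (∀ {j} → j < m → f j ≡ false)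
least-true f zero    fk = zero , fk , λ ()
least-true f (suc k) fk with f zero in f0
... | true  = zero , f0 , λ ()
... | false with m , fm , below ← least-true (f ∘ suc) k fk =
  suc m , fm , λ { {zero} _ → f0 ; {suc j} j<m → below (s≤s⁻¹ j<m) }

injective⇒surjective : (f : Fin n → Fin n) → Injective _≡_ _≡_ f → ∀ j → ∃[ i ] f i ≡ j
injective⇒surjective {suc n} f f-inj j with any? (λ i → f i Fin.≟ j)
... | yes hit = hit
... | no  miss = contradiction (λ {x} {y} eq → f-inj (punchOut-injective (avoid x) (avoid y) eq)) (<⇒notInjective (n<1+n n))
  where
  avoid : ∀ i → j ≢ f i
  avoid i j≡fi = miss (i , sym j≡fi)

injective⇒permutation : (f : Fin n → Fin n) → Injective _≡_ _≡_ f
  → ∃ λ (σ : Permutation′ n) → ∀ v → σ ⟨$⟩ˡ v ≡ f v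
injective⇒permutation f f-inj =
  permutation (proj₁ ∘ onto) f (λ v → f-inj (proj₂ (onto (f v)))) (proj₂ ∘ onto) , λ _ → refl
  where
  onto : ∀ j → ∃[ i ] f i ≡ j
  onto = injective⇒surjective f f-inj

position : Permutation′ n → Fin n → ℕ
position σ v = toℕ (σ ⟨$⟩ˡ v)

position-injective : (σ : Permutation′ n) → Injective _≡_ _≡_ (position σ)
position-injective σ {u} {v} eq = begin
  u                     ≡⟨ inverseʳ σ ⟨
  σ ⟨$⟩ʳ (σ ⟨$⟩ˡ u)     ≡⟨ cong (σ ⟨$⟩ʳ_) (toℕ-injective eq) ⟩
  σ ⟨$⟩ʳ (σ ⟨$⟩ˡ v)     ≡⟨ inverseʳ σ ⟩
  v                     ∎
  where open ≡-Reasoning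

module _ (c : Fin n → ℕ) where

  rank : Fin n → ℕ
  rank v = count (λ u → c u <ᵇ c v)

  rank-mono : ∀ {u v} → c u < c v → rank u < rank v
  rank-mono {u} {v} cu<cv = count-mono-< below-u⇒below-v u (<ᵇ-irrefl (c u)) (<ᵇ-true cu<cv)
    where
    below-u⇒below-v : ∀ w → (c w <ᵇ c u) ≡ true → (c w <ᵇ c v) ≡ true
    below-u⇒below-v w cw<ᵇcu = <ᵇ-true (<-trans (<ᵇ-true⇒< cw<ᵇcu) cu<cv)

  rank<n : ∀ v → rank v < n
  rank<n v = subst (rank v <_) (count-true n) (count-mono-< (λ _ _ → refl) v (<ᵇ-irrefl (c v)) refl)

  rank-injective : Injective _≡_ _≡_ c → Injective _≡_ _≡_ rank
  rank-injective c-injective {u} {v} eq with <-cmp (c u) (c v)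
  ... | tri< cu<cv _ _ = contradiction eq (<⇒≢ (rank-mono cu<cv))
  ... | tri≈ _ cu≡cv _ = c-injective cu≡cv
  ... | tri> _ _ cv<cu = contradiction (sym eq) (<⇒≢ (rank-mono cv<cu))

  sortingPermutation : Injective _≡_ _≡_ c
    → ∃ λ (σ : Permutation′ n) → ∀ {u v} → c u < c v → position σ u < position σ v
  sortingPermutation c-injective = map₂ (λ {σ} → sorted {σ}) (injective⇒permutation rankFin rankFin-injective)
    where
    rankFin : Fin n → Fin n
    rankFin v = fromℕ< (rank<n v)

    rankFin-injective : Injective _≡_ _≡_ rankFin
    rankFin-injective {u} {v} eq = rank-injective c-injective
      (trans (sym (toℕ-fromℕ< (rank<n u))) (trans (cong toℕ eq) (toℕ-fromℕ< (rank<n v))))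

    sorted : ∀ {σ} → (∀ v → σ ⟨$⟩ˡ v ≡ rankFin v) → ∀ {u v} → c u < c v → position σ u < position σ v
    sorted {σ} σ≡rankFin {u} {v} cu<cv = subst₂ _<_ (sym (position≡rank u)) (sym (position≡rank v)) (rank-mono cu<cv)
      where
      position≡rank : ∀ w → position σ w ≡ rank w
      position≡rank w = trans (cong toℕ (σ≡rankFin w)) (toℕ-fromℕ< (rank<n w))

IsActivationKey : Graph n → (Fin n → ℕ) → Subset n → (Fin n → ℕ) → Set
IsActivationKey G t S κ = ∀ u → S u ≡ false → t u ≤ count (λ w → adj G u w ∧ (κ w <ᵇ κ u))

IsActivationKey-refine : ∀ {G : Graph n} {t S κ κ′} → (∀ {u w} → κ w < κ u → κ′ w < κ′ u)
  → IsActivationKey G t S κ → IsActivationKey G t S κ′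
IsActivationKey-refine {G = G} {κ = κ} {κ′} refines κ-key u u∉S = ≤-trans (κ-key u u∉S) (count-mono earlier)
  where
  earlier : ∀ w → (adj G u w ∧ (κ w <ᵇ κ u)) ≡ true → (adj G u w ∧ (κ′ w <ᵇ κ′ u)) ≡ true
  earlier w with adj G u w
  ... | true  = <ᵇ-true ∘ refines ∘ <ᵇ-true⇒<
  ... | false = id

tieBreak : (Fin n → ℕ) → Fin n → ℕ
tieBreak {n} τ v = τ v * n + toℕ v

tieBreak-mono : (τ : Fin n → ℕ) → ∀ {u v} → τ u < τ v → tieBreak τ u < tieBreak τ v
tieBreak-mono {n} τ {u} {v} τu<τv = begin-strict
  τ u * n + toℕ u  <⟨ +-monoʳ-< (τ u * n) (toℕ<n u) ⟩
  τ u * n + n      ≡⟨ +-comm (τ u * n) n ⟩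
  suc (τ u) * n    ≤⟨ *-monoˡ-≤ n τu<τv ⟩
  τ v * n          ≤⟨ m≤m+n _ _ ⟩
  τ v * n + toℕ v  ∎
  where open ≤-Reasoning

tieBreak-injective : (τ : Fin n → ℕ) → Injective _≡_ _≡_ (tieBreak τ)
tieBreak-injective {n} τ {u} {v} eq with <-cmp (τ u) (τ v)
... | tri< τu<τv _ _ = contradiction eq (<⇒≢ (tieBreak-mono τ τu<τv))
... | tri> _ _ τv<τu = contradiction (sym eq) (<⇒≢ (tieBreak-mono τ τv<τu))
... | tri≈ _ τu≡τv _ =
  toℕ-injective (+-cancelˡ-≡ (τ u * n) _ _ (trans eq (cong (λ k → k * n + toℕ v) (sym τu≡τv))))

module ActivationTime (G : Graph n) (t : Fin n → ℕ) (S : Subset n)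
                      (K : ℕ) (allActive : ∀ v → active G t S K v ≡ true) where

  firstActivation : ∀ v → ∃[ m ] active G t S m v ≡ true × (∀ {j} → j < m → active G t S j v ≡ false)
  firstActivation v = least-true (λ k → active G t S k v) K (allActive v)

  τ : Fin n → ℕ
  τ v = proj₁ (firstActivation v)

  τ-minimal : ∀ v k → active G t S k v ≡ true → τ v ≤ k
  τ-minimal v k activeₖ = ≮⇒≥ λ k<τ → true≢false (trans (sym activeₖ) (proj₂ (proj₂ (firstActivation v)) k<τ))

  τ-threshold : ∀ u → S u ≡ false → ∃[ k ] τ u ≡ suc k × t u ≤ count (λ w → adj G u w ∧ active G t S k w)
  τ-threshold u u∉S with firstActivation u
  ... | zero  , u∈S , _      = contradiction (trans (sym u∈S) u∉S) true≢false
  ... | suc k , fired , before = k , refl ,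
    ≤ᵇ⇒≤ (t u) _ (Equivalence.from T-≡ (∨-resolveˡ (before (n<1+n k)) fired))

  τ-isActivationKey : IsActivationKey G t S τ
  τ-isActivationKey u u∉S with k , τu≡1+k , threshold ← τ-threshold u u∉S =
    ≤-trans threshold (count-mono activeEarlier)
    where
    activeEarlier : ∀ w → (adj G u w ∧ active G t S k w) ≡ true → (adj G u w ∧ (τ w <ᵇ τ u)) ≡ true
    activeEarlier w with adj G u w
    ... | true  = λ activeₖ → <ᵇ-true (subst (τ w <_) (sym τu≡1+k) (s≤s (τ-minimal w k activeₖ)))
    ... | false = id

contagious⇒activationOrder : (G : Graph n) (t : Fin n → ℕ) (S : Subset n) → Contagious G t S
  → ∃ λ (σ : Permutation′ n) → IsActivationKey G t S (position σ)
contagious⇒activationOrder G t S (K , allActive) =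
  map₂ (λ sorted → IsActivationKey-refine {G = G} (λ τw<τu → sorted (tieBreak-mono τ τw<τu)) τ-isActivationKey)
       (sortingPermutation (tieBreak τ) (tieBreak-injective τ))
  where open ActivationTime G t S K allActive

module _ (G : Graph n) (t : Fin n → ℕ) (deg≤2t : ∀ v → deg G v ≤ 2 * t v)
         (S : Subset n) (Δ : ℕ) (deg≤Δ : ∀ v → deg G v ≤ Δ)
         (σ : Permutation′ n) (σ-key : IsActivationKey G t S (position σ)) (i : ℕ) where

  private
    P : Subset n
    P = inPrefix σ i

    c : Fin n → ℕ
    c = position σ

    inner : Fin n → Fin n → Bool
    inner u w = P u ∧ adj G u w ∧ P w

    Out In Back Fwd : Fin n → ℕ
    Out  u = ∑[ w < n ] 𝟙 (P u ∧ adj G u w ∧ not (P w))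
    In   u = ∑[ w < n ] 𝟙 (inner u w)
    Back u = ∑[ w < n ] 𝟙 (inner u w ∧ (c w <ᵇ c u))
    Fwd  u = ∑[ w < n ] 𝟙 (inner u w ∧ (c u <ᵇ c w))

    prefix-closed : ∀ {u w} → P u ≡ true → c w < c u → P w ≡ true
    prefix-closed {u} {w} Pu cw<cu = <ᵇ-true {c w} {i} (<-trans cw<cu (<ᵇ-true⇒< {c u} {i} Pu))

    inner-sym : ∀ u w → inner u w ≡ inner w u
    inner-sym u w = trans (cong (λ a → P u ∧ a ∧ P w) (Graph.sym G u w)) (∧-reverse (P u) (adj G w u) (P w))

    inner-untied : ∀ u w → (c w <ᵇ c u) ≡ (c u <ᵇ c w) → inner u w ≡ false
    inner-untied u w tie with u Fin.≟ w
    ... | yes refl = trans (cong (λ a → P u ∧ a ∧ P u) (loopless G u)) (∧-zeroʳ (P u))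
    ... | no  u≢w  = contradiction (<ᵇ-flip (u≢w ∘ position-injective σ)) (not-¬ tie)

    degree-split : ∀ u → 𝟙 (P u) * deg G u ≡ Out u + In u
    degree-split u = begin
      𝟙 (P u) * deg G u                     ≡⟨ cong (𝟙 (P u) *_) (count≡∑ (adj G u)) ⟩
      𝟙 (P u) * ∑[ w < n ] 𝟙 (adj G u w)    ≡⟨ *-distribˡ-sum (𝟙 (P u)) (𝟙 ∘ adj G u) ⟩
      ∑[ w < n ] (𝟙 (P u) * 𝟙 (adj G u w))  ≡⟨ sum-cong-≗ (λ w → 𝟙-∧-split (P u) (adj G u w) (P w)) ⟩
      ∑[ w < n ] (𝟙 (P u ∧ adj G u w ∧ not (P w)) + 𝟙 (inner u w))
        ≡⟨ ∑-distrib-+ (λ w → 𝟙 (P u ∧ adj G u w ∧ not (P w))) (𝟙 ∘ inner u) ⟩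
      Out u + In u                          ∎
      where open ≡-Reasoning

    inner-split : ∀ u → In u ≡ Back u + Fwd u
    inner-split u = trans
      (sum-cong-≗ (λ w → 𝟙-∧-partition (inner u w) (c w <ᵇ c u) (c u <ᵇ c w) (inner-untied u w)))
      (∑-distrib-+ (λ w → 𝟙 (inner u w ∧ (c w <ᵇ c u))) (λ w → 𝟙 (inner u w ∧ (c u <ᵇ c w))))

    forward≡backward : ∑[ u < n ] Fwd u ≡ ∑[ u < n ] Back u
    forward≡backward = trans (∑-comm (λ u w → 𝟙 (inner u w ∧ (c u <ᵇ c w))))
      (sum-cong-≗ (λ w → sum-cong-≗ (λ u → cong (λ b → 𝟙 (b ∧ (c u <ᵇ c w))) (inner-sym u w))))

    earlier⇒inner : ∀ {u} w → P u ≡ true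
      → (adj G u w ∧ (c w <ᵇ c u)) ≡ true → (inner u w ∧ (c w <ᵇ c u)) ≡ true
    earlier⇒inner {u} w Pu with adj G u w | c w <ᵇ c u in cw<ᵇcu
    ... | true  | true  = λ _ → subst (λ b → (b ∧ true ∧ P w) ∧ true ≡ true) (sym Pu)
                                  (cong (λ b → b ∧ true) (prefix-closed Pu (<ᵇ-true⇒< cw<ᵇcu)))
    ... | true  | false = λ ()
    ... | false | _     = λ ()

    earlier≤Back : ∀ u → P u ≡ true → count (λ w → adj G u w ∧ (c w <ᵇ c u)) ≤ Back u
    earlier≤Back u Pu = ≤-trans (≤-reflexive (count≡∑ (λ w → adj G u w ∧ (c w <ᵇ c u))))
                                (∑-mono-≤ (λ w → 𝟙-mono (earlier⇒inner w Pu)))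

    prefix-degree-bound : ∀ u → P u ≡ true → deg G u ≤ 𝟙 (S u) * Δ + 2 * Back u
    prefix-degree-bound u Pu with S u in Su
    ... | true  = ≤-trans (deg≤Δ u) (≤-trans (≤-reflexive (sym (*-identityˡ Δ))) (m≤m+n _ _))
    ... | false = begin
      deg G u                                     ≤⟨ deg≤2t u ⟩
      2 * t u                                     ≤⟨ *-monoʳ-≤ 2 (σ-key u Su) ⟩
      2 * count (λ w → adj G u w ∧ (c w <ᵇ c u))  ≤⟨ *-monoʳ-≤ 2 (earlier≤Back u Pu) ⟩
      2 * Back u                                  ∎
      where open ≤-Reasoning

    ∑Back ∑Out : ℕ
    ∑Back = ∑[ u < n ] Back u
    ∑Out  = ∑[ u < n ] Out u

    handshake : ∑[ u < n ] (𝟙 (P u) * deg G u) ≡ ∑Out + 2 * ∑Back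
    handshake = begin
      ∑[ u < n ] (𝟙 (P u) * deg G u)     ≡⟨ trans (sum-cong-≗ degree-split) (∑-distrib-+ Out In) ⟩
      ∑Out + ∑[ u < n ] In u             ≡⟨ cong (∑Out +_) (trans (sum-cong-≗ inner-split) (∑-distrib-+ Back Fwd)) ⟩
      ∑Out + (∑Back + ∑[ u < n ] Fwd u)  ≡⟨ cong (λ x → ∑Out + (∑Back + x)) (trans forward≡backward (sym (+-identityʳ _))) ⟩
      ∑Out + 2 * ∑Back                   ∎
      where open ≡-Reasoning

    degree-sum-bound : ∑[ u < n ] (𝟙 (P u) * deg G u) ≤ Δ * count S + 2 * ∑Back
    degree-sum-bound = begin
      ∑[ u < n ] (𝟙 (P u) * deg G u)                   ≤⟨ ∑-mono-≤ (λ u → 𝟙*-≤ (P u) (prefix-degree-bound u)) ⟩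
      ∑[ u < n ] (𝟙 (S u) * Δ + 2 * Back u)            ≡⟨ ∑-distrib-+ (λ u → 𝟙 (S u) * Δ) (λ u → 2 * Back u) ⟩
      ∑[ u < n ] (𝟙 (S u) * Δ) + ∑[ u < n ] (2 * Back u) ≡⟨ cong₂ _+_ seeds (sym (*-distribˡ-sum 2 Back)) ⟩
      Δ * count S + 2 * ∑Back                          ∎
      where
      open ≤-Reasoning

      seeds : ∑[ u < n ] (𝟙 (S u) * Δ) ≡ Δ * count S
      seeds = trans (sym (*-distribʳ-sum Δ (𝟙 ∘ S))) (trans (cong (_* Δ) (sym (count≡∑ S))) (*-comm _ Δ))

    cutSize≡∑Out : cutSize G σ i ≡ ∑Out
    cutSize≡∑Out = trans (sum-map-allFin (λ u → count (λ w → P u ∧ adj G u w ∧ not (P w))))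
                         (sum-cong-≗ (λ u → count≡∑ (λ w → P u ∧ adj G u w ∧ not (P w))))

  cutSize-bound : cutSize G σ i ≤ Δ * count S
  cutSize-bound = +-cancelʳ-≤ (2 * ∑Back) _ _ (begin
    cutSize G σ i + 2 * ∑Back             ≡⟨ cong (_+ 2 * ∑Back) cutSize≡∑Out ⟩
    ∑Out + 2 * ∑Back                      ≡⟨ handshake ⟨
    ∑[ u < n ] (𝟙 (P u) * deg G u)        ≤⟨ degree-sum-bound ⟩
    Δ * count S + 2 * ∑Back               ∎)
    where open ≤-Reasoning

width-bound : (G : Graph n) (t : Fin n → ℕ) → (∀ v → deg G v ≤ 2 * t v)
  → (S : Subset n) (Δ : ℕ) → (∀ v → deg G v ≤ Δ)
  → (σ : Permutation′ n) → IsActivationKey G t S (position σ) → width G σ ≤ Δ * count S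
width-bound {n} G t deg≤2t S Δ deg≤Δ σ σ-key =
  maxFin-lub {suc n} {f = λ i → cutSize G σ (toℕ i)} (λ i → cutSize-bound G t deg≤2t S Δ deg≤Δ σ σ-key (toℕ i))

mainTheorem19 : {n : ℕ} (G : Graph n) (t : Fin n → ℕ)
    → (∀ v → deg G v ≤ 2 * t v)
    → (S : Subset n) (r : ℕ) → count S ≡ r → Contagious G t S
    → ∃ λ (σ : Permutation′ n) → width G σ ≤ maxDeg G * r
mainTheorem19 G t deg≤2t S _ refl contagious =
  map₂ (λ {σ} → width-bound G t deg≤2t S (maxDeg G) (≤maxFin (deg G)) σ)
       (contagious⇒activationOrder G t S contagious)
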